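{- Let $s\ge1$, let $(G,k)$ be an instance of $s$-Plex Cluster Vertex Deletion with $G=(V,E)$, let $X\subseteq V$ be such that $G-X$ is an $s$-plex cluster graph, let $H$ be the vertex set of a connected component of $G-X$, and let $R(H)\subseteq H$ be redundant. If $|R(H)|>k+2s-1$ and $u\in R(H)$ is arbitrary, then $(G,k)$ is a yes-instance if and only if $(G-\{u\},k)$ is a yes-instance.
   Context: All graphs are finite, simple and undirected; $N(v)$ is the set of neighbors of $v$. An $s$-plex is a graph in which every vertex is nonadjacent to at most $s-1$ other vertices; an $s$-plex cluster graph is a graph each of whose connected components is an $s$-plex. $s$-Plex Cluster Vertex Deletion: given $G=(V,E)$ and $k$, decide whether there is $S\subseteq V$, $|S|\le k$, with $G-S$ an $s$-plex cluster graph. For $W\subseteq V$, a set $Z\subseteq V$ is a $W$-module if $N(u)\cap W=N(v)\cap W$ for all $u,v\in Z$. Given $X$ and a component vertex set $H$ of $G-X$, a set $R(H)\subseteq H$ is redundant if $R(H)$ is an $X$-module and there exists an $X$-module $Z(H)$ with $R(H)\subseteq Z(H)\subseteq H$ containing every vertex of $H$ that is nonadjacent to some vertex of $R(H)$. -}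

module Defs where

open import Data.Nat using (ℕ; _≤_; _<_; _+_; _*_; _∸_)
open import Data.Bool using (Bool; true; false)
open import Data.Fin using (Fin)
open import Data.Fin.Subset using (Subset; _∈_; _∉_; _⊆_; ∣_∣; ⊤; _─_; ⁅_⁆)
open import Data.Product using (Σ; ∃; _×_; _,_)
open import Relation.Binary.PropositionalEquality using (_≡_; _≢_)
open import Function.Bundles using (_⇔_)

record Graph (n : ℕ) : Set where
  field
    E       : Fin n → Fin n → Bool
    sym     : ∀ u v → E u v ≡ E v u
    irrefl  : ∀ v → E v v ≡ false

open Graph public

module _ {n : ℕ} (G : Graph n) where

  Adj : Fin n → Fin n → Set
  Adj u v = E G u v ≡ true

  NonAdj : Fin n → Fin n → Set
  NonAdj u v = E G u v ≡ false

  -- Reach W x y : y is reachable from x in the induced subgraph G[W]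
  -- (G[W] is "G minus the complement of W").
  data Reach (W : Subset n) (x : Fin n) : Fin n → Set where
    here : x ∈ W → Reach W x x
    step : ∀ {y z} → Reach W x y → z ∈ W → Adj y z → Reach W x z

  IsSPlexCluster : ℕ → Subset n → Set
  IsSPlexCluster s W =
    ∀ v → v ∈ W →
      Σ (Subset n) λ T → ∣ T ∣ ≤ s ∸ 1 ×
        (∀ w → Reach W v w → w ≢ v → NonAdj v w → w ∈ T)

  YesInstanceOn : ℕ → Subset n → ℕ → Set
  YesInstanceOn s W k =
    Σ (Subset n) λ S → S ⊆ W × ∣ S ∣ ≤ k × IsSPlexCluster s (W ─ S)

  YesInstance : ℕ → ℕ → Set
  YesInstance s k = YesInstanceOn s ⊤ k

  IsModule : Subset n → Subset n → Set
  IsModule W Z = ∀ u v → u ∈ Z → v ∈ Z → ∀ w → w ∈ W → (Adj u w ⇔ Adj v w)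

  IsComponentOf : Subset n → Subset n → Set
  IsComponentOf X H =
    Σ (Fin n) λ h → h ∈ H × (∀ y → (y ∈ H ⇔ Reach (⊤ ─ X) h y))

  IsRedundant : Subset n → Subset n → Subset n → Set
  IsRedundant X H R =
    R ⊆ H × IsModule X R ×
    Σ (Subset n) λ Z → R ⊆ Z × Z ⊆ H × IsModule X Z ×
      (∀ h → h ∈ H → (Σ (Fin n) λ r → r ∈ R × h ≢ r × NonAdj h r) → h ∈ Z)

module Submission where

-- Write s = t + 1.  A solution S for G
-- gives the solution S - u for G - u, as s-plex cluster graphs are closed
-- under induced subgraphs.  Conversely let S solve G - u, W = V - S and
-- W' = W - u.  Then R' = R - (S ∪ {u}) has at least |R| - k - 1 ≥ 2t + 1
-- vertices, and every vertex of the component H of G - X misses at most t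
-- vertices of H.  So any two vertices of R' are adjacent or have a common
-- neighbour in R', every vertex of H ∩ W' sees R', and every neighbour of u
-- lies in H or (in X) sees the X-module R: all of these lie in one component
-- of G[W'], which u merely enlarges.  A vertex of that component outside H
-- cannot miss all of R', so the non-neighbours of the module Z stay in H,
-- and every other vertex inherits its bound from G[W'].

open import Data.Nat using (ℕ; suc; _≤_; _<_; _+_; _*_; _∸_; z≤n; s≤s)
open import Data.Nat.Properties
  using (≤-trans; ≤-reflexive; ≤-<-trans; m≤m+n; +-suc; +-comm; +-monoʳ-≤; +-mono-≤; +-cancelʳ-≤; n≤1+n; <⇒≱; module ≤-Reasoning)
open import Data.Nat.Tactic.RingSolver using (solve-∀)
open import Data.Fin using (Fin; _≟_)
open import Data.Fin.Properties using (any?)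
open import Data.Fin.Subset using (Subset; _∈_; _∉_; _⊆_; ∣_∣; ⊤; _─_; _∪_; ⁅_⁆; inside; outside) renaming (⊥ to ∅)
open import Data.Fin.Subset.Properties
  using (_∈?_; ∈⊤; ⊆⊤; p⊆q⇒∣p∣≤∣q∣; p─q⊆p; x∈p∧x∉q⇒x∈p─q; x∈p∧x≢y⇒x∈p-y; x∈⁅x⁆; x∈p∪q⁺; ∣⁅x⁆∣≡1; ∣p─q∣≤∣p∣; ∣⊥∣≡0)
open import Data.Vec.Base using (_∷_; []; here; there)
open import Data.Bool using (true; false)
open import Data.Product using (Σ; ∃; _×_; _,_; proj₁; proj₂)
open import Data.Sum using (_⊎_; inj₁; inj₂)
open import Data.Empty using (⊥; ⊥-elim)
open import Relation.Nullary using (yes; no; contradiction)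
open import Relation.Nullary.Decidable using (_×-dec_; ¬?)
open import Relation.Binary.PropositionalEquality using (_≡_; _≢_; refl; trans; cong) renaming (sym to ≡-sym)
open import Function.Base using (_∘_)
open import Function.Bundles using (_⇔_; mk⇔; Equivalence)
open import Defs

x∈p─q⇒x∉q : ∀ {n} {x : Fin n} (p q : Subset n) → x ∈ p ─ q → x ∉ q
x∈p─q⇒x∉q (inside ∷ p) (outside ∷ q) here ()
x∈p─q⇒x∉q (_ ∷ p) (_ ∷ q) (there x∈p─q) (there x∈q) = x∈p─q⇒x∉q p q x∈p─q x∈q

∣p∪q∣≤∣p∣+∣q∣ : ∀ {n} (p q : Subset n) → ∣ p ∪ q ∣ ≤ ∣ p ∣ + ∣ q ∣
∣p∪q∣≤∣p∣+∣q∣ [] [] = z≤n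
∣p∪q∣≤∣p∣+∣q∣ (inside ∷ p) (inside ∷ q) = s≤s (≤-trans (∣p∪q∣≤∣p∣+∣q∣ p q) (+-monoʳ-≤ ∣ p ∣ (n≤1+n _)))
∣p∪q∣≤∣p∣+∣q∣ (inside ∷ p) (outside ∷ q) = s≤s (∣p∪q∣≤∣p∣+∣q∣ p q)
∣p∪q∣≤∣p∣+∣q∣ (outside ∷ p) (inside ∷ q) rewrite +-suc ∣ p ∣ ∣ q ∣ = s≤s (∣p∪q∣≤∣p∣+∣q∣ p q)
∣p∪q∣≤∣p∣+∣q∣ (outside ∷ p) (outside ∷ q) = ∣p∪q∣≤∣p∣+∣q∣ p q

∣p∣≤∣p─q∣+∣q∣ : ∀ {n} (p q : Subset n) → ∣ p ∣ ≤ ∣ p ─ q ∣ + ∣ q ∣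
∣p∣≤∣p─q∣+∣q∣ [] [] = z≤n
∣p∣≤∣p─q∣+∣q∣ (inside ∷ p) (inside ∷ q) = ≤-trans (s≤s (∣p∣≤∣p─q∣+∣q∣ p q)) (≤-reflexive (≡-sym (+-suc _ _)))
∣p∣≤∣p─q∣+∣q∣ (outside ∷ p) (inside ∷ q) =
  ≤-trans (∣p∣≤∣p─q∣+∣q∣ p q) (≤-trans (n≤1+n _) (≤-reflexive (≡-sym (+-suc _ _))))
∣p∣≤∣p─q∣+∣q∣ (inside ∷ p) (outside ∷ q) = s≤s (∣p∣≤∣p─q∣+∣q∣ p q)
∣p∣≤∣p─q∣+∣q∣ (outside ∷ p) (outside ∷ q) = ∣p∣≤∣p─q∣+∣q∣ p q

∃-∉ : ∀ {n} (A T : Subset n) → ∣ T ∣ < ∣ A ∣ → ∃ λ x → x ∈ A × x ∉ T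
∃-∉ A T ∣T∣<∣A∣ with any? (λ x → (x ∈? A) ×-dec ¬? (x ∈? T))
... | yes found = found
... | no none = contradiction (p⊆q⇒∣p∣≤∣q∣ A⊆T) (<⇒≱ ∣T∣<∣A∣)
  where
  A⊆T : A ⊆ T
  A⊆T {x} x∈A with x ∈? T
  ... | yes x∈T = x∈T
  ... | no x∉T = contradiction (x , x∈A , x∉T) none

surplus : ∀ k t {a c} → k + 2 * suc t ∸ 1 < c → c ≤ a + suc k → suc (t + t) ≤ a
surplus k t {a} {c} k+2s-1<c c≤a+k+1 = +-cancelʳ-≤ (suc k) (suc (t + t)) a (begin
  suc (t + t) + suc k      ≡⟨ +-suc (suc (t + t)) k ⟩
  suc (suc (t + t) + k)    ≡⟨ cong (λ m → suc (m ∸ 1)) (≡-sym (k+2s≡2t+2+k k t)) ⟩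
  suc (k + 2 * suc t ∸ 1)  ≤⟨ k+2s-1<c ⟩
  c                        ≤⟨ c≤a+k+1 ⟩
  a + suc k                ∎)
  where
  open ≤-Reasoning
  k+2s≡2t+2+k : ∀ k t → k + 2 * suc t ≡ suc (suc (t + t) + k)
  k+2s≡2t+2+k = solve-∀

module GraphFacts {n : ℕ} (G : Graph n) where

  adj-or-nonAdj : ∀ x y → Adj G x y ⊎ NonAdj G x y
  adj-or-nonAdj x y with E G x y
  ... | true = inj₁ refl
  ... | false = inj₂ refl

  adj-sym : ∀ {x y} → Adj G x y → Adj G y x
  adj-sym {x} {y} xy = trans (Graph.sym G y x) xy

  nonAdj-sym : ∀ {x y} → NonAdj G x y → NonAdj G y x
  nonAdj-sym {x} {y} xy = trans (Graph.sym G y x) xy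

  adj∧nonAdj⇒⊥ : ∀ {x y} → Adj G x y → NonAdj G x y → ⊥
  adj∧nonAdj⇒⊥ xy non with trans (≡-sym xy) non
  ... | ()

  reach-source : ∀ {W x y} → Reach G W x y → x ∈ W
  reach-source (here x∈W) = x∈W
  reach-source (step r _ _) = reach-source r

  reach-target : ∀ {W x y} → Reach G W x y → y ∈ W
  reach-target (here y∈W) = y∈W
  reach-target (step _ y∈W _) = y∈W

  reach-trans : ∀ {W x y z} → Reach G W x y → Reach G W y z → Reach G W x z
  reach-trans r (here _) = r
  reach-trans r (step r' z∈W adj) = step (reach-trans r r') z∈W adj

  reach-sym : ∀ {W x y} → Reach G W x y → Reach G W y x
  reach-sym (here x∈W) = here x∈W
  reach-sym (step r z∈W adj) =
    reach-trans (step (here z∈W) (reach-target r) (adj-sym adj)) (reach-sym r)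

  reach-mono : ∀ {W W' x y} → W ⊆ W' → Reach G W x y → Reach G W' x y
  reach-mono W⊆W' (here x∈W) = here (W⊆W' x∈W)
  reach-mono W⊆W' (step r z∈W adj) = step (reach-mono W⊆W' r) (W⊆W' z∈W) adj

  -- Being an s-plex cluster graph is inherited by induced subgraphs: the
  -- components only shrink, so the old non-neighbour sets still suffice.
  splex-⊆ : ∀ {s W W'} → W' ⊆ W → IsSPlexCluster G s W → IsSPlexCluster G s W'
  splex-⊆ W'⊆W cluster v v∈W' with cluster v (W'⊆W v∈W')
  ... | T , ∣T∣≤ , covers = T , ∣T∣≤ , λ w r → covers w (reach-mono W'⊆W r)

  few-nonNeighbours : ∀ {s W w} (A : Subset n) → IsSPlexCluster G s W → w ∈ W →
    s ∸ 1 < ∣ A ∣ → (∀ r → r ∈ A → Reach G W w r × r ≢ w × NonAdj G w r) → ⊥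
  few-nonNeighbours {w = w} A cluster w∈W big missed with cluster w w∈W
  ... | T , ∣T∣≤ , covers = <⇒≱ big (≤-trans (p⊆q⇒∣p∣≤∣q∣ A⊆T) ∣T∣≤)
    where
    A⊆T : A ⊆ T
    A⊆T {r} r∈A with missed r r∈A
    ... | reach , r≢w , non = covers r reach r≢w non

module Component {n : ℕ} (G : Graph n) (s : ℕ) (X : Subset n)
  (clusterX : IsSPlexCluster G s (⊤ ─ X))
  (H : Subset n) (component : IsComponentOf G X H) where

  open GraphFacts G

  private
    h₀ : Fin n
    h₀ = proj₁ component

    from-h₀ : ∀ {y} → y ∈ H → Reach G (⊤ ─ X) h₀ y
    from-h₀ {y} = Equivalence.to (proj₂ (proj₂ component) y)

    to-H : ∀ {y} → Reach G (⊤ ─ X) h₀ y → y ∈ H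
    to-H {y} = Equivalence.from (proj₂ (proj₂ component) y)

  reach-in-H : ∀ {a b} → a ∈ H → b ∈ H → Reach G (⊤ ─ X) a b
  reach-in-H a∈H b∈H = reach-trans (reach-sym (from-h₀ a∈H)) (from-h₀ b∈H)

  H-closed : ∀ {a b} → a ∈ H → b ∉ X → Adj G a b → b ∈ H
  H-closed a∈H b∉X adj = to-H (step (from-h₀ a∈H) (x∈p∧x∉q⇒x∈p─q ∈⊤ b∉X) adj)

  nonNbrs : (a : Fin n) → a ∈ H → Subset n
  nonNbrs a a∈H = proj₁ (clusterX a (reach-target (from-h₀ a∈H)))

  ∣nonNbrs∣≤ : ∀ {a} (a∈H : a ∈ H) → ∣ nonNbrs a a∈H ∣ ≤ s ∸ 1
  ∣nonNbrs∣≤ {a} a∈H with clusterX a (reach-target (from-h₀ a∈H))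
  ... | _ , ∣T∣≤ , _ = ∣T∣≤

  nonNbrs-complete : ∀ {a b} (a∈H : a ∈ H) → b ∈ H → b ≢ a → NonAdj G a b → b ∈ nonNbrs a a∈H
  nonNbrs-complete {a} {b} a∈H b∈H b≢a non with clusterX a (reach-target (from-h₀ a∈H))
  ... | _ , _ , covers = covers b (reach-in-H a∈H b∈H) b≢a non

  adjacent-outside-nonNbrs : ∀ {a b} (a∈H : a ∈ H) → b ∈ H → b ≢ a → b ∉ nonNbrs a a∈H → Adj G a b
  adjacent-outside-nonNbrs {a} {b} a∈H b∈H b≢a b∉T with adj-or-nonAdj a b
  ... | inj₁ adj = adj
  ... | inj₂ non = contradiction (nonNbrs-complete a∈H b∈H b≢a non) b∉T

  common-neighbour : ∀ {a b m} (a∈H : a ∈ H) (b∈H : b ∈ H) → a ≢ b → NonAdj G a b →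
    m ∈ H → m ∉ nonNbrs a a∈H ∪ nonNbrs b b∈H → Adj G a m × Adj G m b
  common-neighbour {a} {b} {m} a∈H b∈H a≢b non m∈H m∉T =
    adjacent-outside-nonNbrs a∈H m∈H m≢a m∉Ta ,
    adj-sym (adjacent-outside-nonNbrs b∈H m∈H m≢b m∉Tb)
    where
    m∉Ta : m ∉ nonNbrs a a∈H
    m∉Ta m∈Ta = m∉T (x∈p∪q⁺ (inj₁ m∈Ta))
    m∉Tb : m ∉ nonNbrs b b∈H
    m∉Tb m∈Tb = m∉T (x∈p∪q⁺ (inj₂ m∈Tb))
    m≢a : m ≢ a
    m≢a refl = m∉Tb (nonNbrs-complete b∈H a∈H a≢b (nonAdj-sym non))
    m≢b : m ≢ b
    m≢b refl = m∉Ta (nonNbrs-complete a∈H b∈H (λ b≡a → a≢b (≡-sym b≡a)) non)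

-- Re-attaching a vertex u to G[W'], where W' = W - u, when every neighbour
-- of u in W' is connected to a fixed vertex c: the components of G[W] are
-- those of G[W'], except that u joins the component of c.

module Reattach {n : ℕ} (G : Graph n) (W W' : Subset n) (u c : Fin n)
  (W'⊆W : W' ⊆ W) (u∉W' : u ∉ W') (into-W' : ∀ {x} → x ∈ W → x ≢ u → x ∈ W')
  (u-nbrs : ∀ {z} → z ∈ W' → Adj G u z → Reach G W' c z) where

  open GraphFacts G

  walk-split : ∀ {v w} → Reach G W v w → Reach G W' v w ⊎ (w ≡ u ⊎ Reach G W' c w)
  walk-split {v} (here v∈W) with v ≟ u
  ... | yes v≡u = inj₂ (inj₁ v≡u)
  ... | no v≢u = inj₁ (here (into-W' v∈W v≢u))
  walk-split (step {z = z} r z∈W adj) with z ≟ u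
  ... | yes z≡u = inj₂ (inj₁ z≡u)
  ... | no z≢u with walk-split r
  ...   | inj₁ r' = inj₁ (step r' (into-W' z∈W z≢u) adj)
  ...   | inj₂ (inj₁ refl) = inj₂ (inj₂ (u-nbrs (into-W' z∈W z≢u) adj))
  ...   | inj₂ (inj₂ c→z) = inj₂ (inj₂ (step c→z (into-W' z∈W z≢u) adj))

  from-c : ∀ {x} → Reach G W c x → x ≢ u → Reach G W' c x
  from-c r x≢u with walk-split r
  ... | inj₁ r' = r'
  ... | inj₂ (inj₁ x≡u) = ⊥-elim (x≢u x≡u)
  ... | inj₂ (inj₂ r') = r'

  avoid-u : ∀ {v w} → Reach G W v w → v ≢ u → w ≢ u → Reach G W' v w
  avoid-u r v≢u w≢u with walk-split r
  ... | inj₁ r' = r'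
  ... | inj₂ (inj₁ w≡u) = ⊥-elim (w≢u w≡u)
  ... | inj₂ (inj₂ c→w) =
    reach-trans (reach-sym (from-c (reach-trans (reach-mono W'⊆W c→w) (reach-sym r)) v≢u)) c→w

  reaches-u : ∀ {v} → Reach G W v u → v ≢ u → Reach G W' c v
  reaches-u r v≢u with walk-split (reach-sym r)
  ... | inj₁ u→v = ⊥-elim (u∉W' (reach-source u→v))
  ... | inj₂ (inj₁ v≡u) = ⊥-elim (v≢u v≡u)
  ... | inj₂ (inj₂ c→v) = c→v

restrict : ∀ {n} (G : Graph n) (s k : ℕ) (u : Fin n) →
  YesInstance G s k → YesInstanceOn G s (⊤ ─ ⁅ u ⁆) k
restrict G s k u (S , _ , ∣S∣≤k , cluster) =
  S ─ ⁅ u ⁆ , S-u⊆V-u , ≤-trans (∣p─q∣≤∣p∣ S ⁅ u ⁆) ∣S∣≤k , GraphFacts.splex-⊆ G {s = s} shrinks cluster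
  where
  S-u⊆V-u : S ─ ⁅ u ⁆ ⊆ ⊤ ─ ⁅ u ⁆
  S-u⊆V-u x∈S-u = x∈p∧x∉q⇒x∈p─q ∈⊤ (x∈p─q⇒x∉q S ⁅ u ⁆ x∈S-u)
  shrinks : (⊤ ─ ⁅ u ⁆) ─ (S ─ ⁅ u ⁆) ⊆ ⊤ ─ S
  shrinks {x} x∈W = x∈p∧x∉q⇒x∈p─q ∈⊤ λ x∈S →
    x∈p─q⇒x∉q (⊤ ─ ⁅ u ⁆) (S ─ ⁅ u ⁆) x∈W
      (x∈p∧x∉q⇒x∈p─q x∈S (x∈p─q⇒x∉q ⊤ ⁅ u ⁆ (p─q⊆p _ (S ─ ⁅ u ⁆) x∈W)))

module Extend (t : ℕ) {n : ℕ} (G : Graph n) (k : ℕ) (X : Subset n)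
  (clusterX : IsSPlexCluster G (suc t) (⊤ ─ X))
  (H : Subset n) (component : IsComponentOf G X H)
  (R Z : Subset n) (R⊆Z : R ⊆ Z) (Z⊆H : Z ⊆ H) (moduleR : IsModule G X R) (moduleZ : IsModule G X Z)
  (Z-covers : ∀ h → h ∈ H → (Σ (Fin n) λ r → r ∈ R × h ≢ r × NonAdj G h r) → h ∈ Z)
  (big : k + 2 * suc t ∸ 1 < ∣ R ∣)
  (u : Fin n) (u∈R : u ∈ R)
  (S : Subset n) (S⊆V-u : S ⊆ ⊤ ─ ⁅ u ⁆) (∣S∣≤k : ∣ S ∣ ≤ k)
  (clusterS : IsSPlexCluster G (suc t) ((⊤ ─ ⁅ u ⁆) ─ S)) where

  open GraphFacts G
  open Component G (suc t) X clusterX H component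

  W W' R' : Subset n
  W = ⊤ ─ S
  W' = (⊤ ─ ⁅ u ⁆) ─ S
  R' = R ─ (S ∪ ⁅ u ⁆)

  R⊆H : R ⊆ H
  R⊆H r∈R = Z⊆H (R⊆Z r∈R)

  u∈Z : u ∈ Z
  u∈Z = R⊆Z u∈R

  ∉Z⇒≢u : ∀ {v} → v ∉ Z → v ≢ u
  ∉Z⇒≢u v∉Z refl = v∉Z u∈Z

  W'⊆W : W' ⊆ W
  W'⊆W x∈W' = x∈p∧x∉q⇒x∈p─q ∈⊤ (x∈p─q⇒x∉q (⊤ ─ ⁅ u ⁆) S x∈W')

  u∉W' : u ∉ W'
  u∉W' u∈W' = x∈p─q⇒x∉q ⊤ ⁅ u ⁆ (p─q⊆p _ S u∈W') (x∈⁅x⁆ u)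

  into-W' : ∀ {x} → x ∈ W → x ≢ u → x ∈ W'
  into-W' x∈W x≢u = x∈p∧x∉q⇒x∈p─q (x∈p∧x≢y⇒x∈p-y ∈⊤ x≢u) (x∈p─q⇒x∉q ⊤ S x∈W)

  R'⊆R : R' ⊆ R
  R'⊆R = p─q⊆p R (S ∪ ⁅ u ⁆)

  R'⊆H : R' ⊆ H
  R'⊆H r∈R' = R⊆H (R'⊆R r∈R')

  R'⊆W' : R' ⊆ W'
  R'⊆W' r∈R' = x∈p∧x∉q⇒x∈p─q (x∈p∧x∉q⇒x∈p─q ∈⊤ (r∉ ∘ inj₂)) (r∉ ∘ inj₁)
    where
    r∉ = λ r∈ → x∈p─q⇒x∉q R (S ∪ ⁅ u ⁆) r∈R' (x∈p∪q⁺ r∈)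

  ∣R'∣-large : suc (t + t) ≤ ∣ R' ∣
  ∣R'∣-large = surplus k t big (begin
    ∣ R ∣                           ≤⟨ ∣p∣≤∣p─q∣+∣q∣ R (S ∪ ⁅ u ⁆) ⟩
    ∣ R' ∣ + ∣ S ∪ ⁅ u ⁆ ∣          ≤⟨ +-monoʳ-≤ ∣ R' ∣ (∣p∪q∣≤∣p∣+∣q∣ S ⁅ u ⁆) ⟩
    ∣ R' ∣ + (∣ S ∣ + ∣ ⁅ u ⁆ ∣)    ≡⟨ cong (λ m → ∣ R' ∣ + (∣ S ∣ + m)) (∣⁅x⁆∣≡1 u) ⟩
    ∣ R' ∣ + (∣ S ∣ + 1)            ≡⟨ cong (∣ R' ∣ +_) (+-comm ∣ S ∣ 1) ⟩
    ∣ R' ∣ + suc ∣ S ∣              ≤⟨ +-monoʳ-≤ ∣ R' ∣ (s≤s ∣S∣≤k) ⟩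
    ∣ R' ∣ + suc k                  ∎)
    where open ≤-Reasoning

  t<∣R'∣ : t < ∣ R' ∣
  t<∣R'∣ = ≤-trans (s≤s (m≤m+n t t)) ∣R'∣-large

  -- A base vertex r₀ of R'; its component in G[W'] will absorb u.
  r₀-exists : ∃ λ r → r ∈ R' × r ∉ ∅
  r₀-exists = ∃-∉ R' ∅ (≤-trans (s≤s (≤-reflexive (∣⊥∣≡0 n))) (≤-trans (s≤s z≤n) ∣R'∣-large))

  r₀ : Fin n
  r₀ = proj₁ r₀-exists

  r₀∈R' : r₀ ∈ R'
  r₀∈R' = proj₁ (proj₂ r₀-exists)

  r₀∈W' : r₀ ∈ W'
  r₀∈W' = R'⊆W' r₀∈R'

  -- All of R' lies in the component of r₀: two non-adjacent vertices of R'
  -- miss at most 2t vertices of H together, so some vertex of R' sees both.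
  R'-connected : ∀ {r} → r ∈ R' → Reach G W' r₀ r
  R'-connected {r} r∈R' with r ≟ r₀ | adj-or-nonAdj r₀ r
  ... | yes refl | _ = here r₀∈W'
  ... | no _ | inj₁ adj = step (here r₀∈W') (R'⊆W' r∈R') adj
  ... | no r≢r₀ | inj₂ non with ∃-∉ R' (nonNbrs r₀ r₀∈H ∪ nonNbrs r r∈H) few
    where
    r₀∈H = R'⊆H r₀∈R'
    r∈H = R'⊆H r∈R'
    few = ≤-<-trans (≤-trans (∣p∪q∣≤∣p∣+∣q∣ (nonNbrs r₀ r₀∈H) (nonNbrs r r∈H)) (+-mono-≤ (∣nonNbrs∣≤ r₀∈H) (∣nonNbrs∣≤ r∈H))) ∣R'∣-large
  ... | m , m∈R' , m∉T with common-neighbour (R'⊆H r₀∈R') (R'⊆H r∈R') (r≢r₀ ∘ ≡-sym) non (R'⊆H m∈R') m∉T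
  ... | r₀m , mr = step (step (here r₀∈W') (R'⊆W' m∈R') r₀m) (R'⊆W' r∈R') mr

  -- Every vertex of H in W' has a neighbour in R' (or lies in R'), as it
  -- misses at most t < ∣ R' ∣ vertices of H.
  H-connected : ∀ {x} → x ∈ H → x ∈ W' → Reach G W' r₀ x
  H-connected {x} x∈H x∈W' with ∃-∉ R' (nonNbrs x x∈H) (≤-<-trans (∣nonNbrs∣≤ x∈H) t<∣R'∣)
  ... | m , m∈R' , m∉T with m ≟ x
  ... | yes refl = R'-connected m∈R'
  ... | no m≢x =
    step (R'-connected m∈R') x∈W' (adj-sym (adjacent-outside-nonNbrs x∈H (R'⊆H m∈R') m≢x m∉T))

  -- Neighbours of u in W' are in the component of r₀: those in X see r₀
  -- since R is an X-module, the others lie in H.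
  u-nbrs-connected : ∀ {z} → z ∈ W' → Adj G u z → Reach G W' r₀ z
  u-nbrs-connected {z} z∈W' uz with z ∈? X
  ... | yes z∈X = step (here r₀∈W') z∈W' (Equivalence.to (moduleR u r₀ u∈R (R'⊆R r₀∈R') z z∈X) uz)
  ... | no z∉X = H-connected (H-closed (R⊆H u∈R) z∉X uz) z∈W'

  open Reattach G W W' u r₀ W'⊆W u∉W' into-W' u-nbrs-connected

  -- A vertex outside H missing some v ∈ Z misses all of R: it cannot be in
  -- X (Z is an X-module containing R) and cannot neighbour H outside X.
  misses-R : ∀ {v w r} → v ∈ Z → w ∉ H → NonAdj G v w → r ∈ R → NonAdj G w r
  misses-R {v} {w} {r} v∈Z w∉H non r∈R with adj-or-nonAdj w r
  ... | inj₂ wr = wr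
  ... | inj₁ wr with w ∈? X
  ... | yes w∈X = ⊥-elim (adj∧nonAdj⇒⊥ (Equivalence.to (moduleZ r v (R⊆Z r∈R) v∈Z w w∈X) (adj-sym wr)) non)
  ... | no w∉X = ⊥-elim (w∉H (H-closed (R⊆H r∈R) w∉X (adj-sym wr)))

  -- Non-neighbours of a vertex v ∈ Z within its component of G[W] lie in H:
  -- otherwise such a w would lie in the component of r₀ in G[W'] and miss
  -- all t + 1 or more vertices of R' there.
  Z-nonNbrs-in-H : ∀ {v w} → v ∈ Z → Reach G W v w → NonAdj G v w → w ∈ H
  Z-nonNbrs-in-H {v} {w} v∈Z v→w non with w ∈? H
  ... | yes w∈H = w∈H
  ... | no w∉H = ⊥-elim (few-nonNeighbours {s = suc t} R' clusterS (reach-target r₀→w) t<∣R'∣ missed)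
    where
    w≢u : w ≢ u
    w≢u refl = w∉H (R⊆H u∈R)
    r₀→w : Reach G W' r₀ w
    r₀→w with v ≟ u
    ... | yes refl = reaches-u (reach-sym v→w) w≢u
    ... | no v≢u = reach-trans (H-connected (Z⊆H v∈Z) (into-W' (reach-source v→w) v≢u)) (avoid-u v→w v≢u w≢u)
    missed : ∀ r → r ∈ R' → Reach G W' w r × r ≢ w × NonAdj G w r
    missed r r∈R' =
      reach-trans (reach-sym r₀→w) (R'-connected r∈R') ,
      (λ { refl → w∉H (R'⊆H r∈R') }) ,
      misses-R v∈Z w∉H non (R'⊆R r∈R')

  -- Vertices of Z keep their non-neighbour
  -- sets from G - X; any other vertex v ≠ u keeps the one from G[W'], since
  -- u is adjacent to v (else v ∈ H would force v ∈ Z, and v ∉ H is excluded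
  -- by Z-nonNbrs-in-H applied to u).
  extends : IsSPlexCluster G (suc t) W
  extends v v∈W with v ∈? Z
  ... | yes v∈Z = nonNbrs v (Z⊆H v∈Z) , ∣nonNbrs∣≤ (Z⊆H v∈Z) ,
    λ w v→w w≢v non → nonNbrs-complete (Z⊆H v∈Z) (Z-nonNbrs-in-H v∈Z v→w non) w≢v non
  ... | no v∉Z with clusterS v (into-W' v∈W (∉Z⇒≢u v∉Z))
  ... | T , ∣T∣≤ , covers = T , ∣T∣≤ , covers-W
    where
    covers-W : ∀ w → Reach G W v w → w ≢ v → NonAdj G v w → w ∈ T
    covers-W w v→w w≢v non with w ≟ u
    ... | no w≢u = covers w (avoid-u v→w (∉Z⇒≢u v∉Z) w≢u) w≢v non
    ... | yes refl = ⊥-elim (v∉Z (Z-covers v v∈H (u , u∈R , ∉Z⇒≢u v∉Z , non)))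
      where
      v∈H : v ∈ H
      v∈H = Z-nonNbrs-in-H u∈Z (reach-sym v→w) (nonAdj-sym non)

mainTheorem10 : (s : ℕ) → 1 ≤ s → {n : ℕ} → (G : Graph n) → (k : ℕ) →
    (X : Subset n) → IsSPlexCluster G s (⊤ ─ X) →
    (H : Subset n) → IsComponentOf G X H →
    (R : Subset n) → IsRedundant G X H R →
    k + 2 * s ∸ 1 < ∣ R ∣ →
    (u : Fin n) → u ∈ R →
    (YesInstance G s k ⇔ YesInstanceOn G s (⊤ ─ ⁅ u ⁆) k)
mainTheorem10 (suc t) _ G k X clusterX H component R (_ , moduleR , Z , R⊆Z , Z⊆H , moduleZ , Z-covers) big u u∈R =
  mk⇔ (restrict G (suc t) k u) extend
  where
  extend : YesInstanceOn G (suc t) (⊤ ─ ⁅ u ⁆) k → YesInstance G (suc t) k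
  extend (S , S⊆V-u , ∣S∣≤k , clusterS) = S , ⊆⊤ , ∣S∣≤k ,
    Extend.extends t G k X clusterX H component R Z R⊆Z Z⊆H moduleR moduleZ Z-covers big u u∈R S S⊆V-u ∣S∣≤k clusterS
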